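{- Let $q=p^r$ with $p$ prime and $r\ge1$, let $n$ be a positive integer, and let $\ker(\mathrm{Tr})=\{x\in\mathbb{F}_{q^n}:\sum_{i=0}^{n-1}x^{q^i}=0\}$. Let $k$ be a positive integer with $\gcd(k,n)=1$ and let $c\in\mathbb{F}_q$. Then $x^{p^k}-cx$ permutes $\ker(\mathrm{Tr})$ (i.e., maps it bijectively onto itself) in either of the following cases: (1) $c^{(q-1)/(p^{\gcd(k,r)}-1)}=1$ and $p\nmid n$; or (2) $c^{n(q-1)/(p^{\gcd(k,r)}-1)}\neq 1$. -}

module Defs where

open import Level using (Level; _⊔_) renaming (suc to lsuc)
open import Algebra.Bundles using (CommutativeRing)
open import Data.Nat using (ℕ; zero; suc)
import Data.Nat as ℕ
open import Data.Fin using (Fin)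
open import Data.Product using (∃; _×_)
open import Relation.Nullary using (¬_)
open import Relation.Binary.PropositionalEquality using (_≡_)

record Field (c ℓ : Level) : Set (lsuc (c ⊔ ℓ)) where
  field
    commutativeRing : CommutativeRing c ℓ
  open CommutativeRing commutativeRing public
  field
    1≉0     : ¬ (1# ≈ 0#)
    inverse : ∀ x → ¬ (x ≈ 0#) → ∃ λ y → (x * y) ≈ 1#

module _ {c ℓ : Level} (F : Field c ℓ) where
  open Field F

  pow : Carrier → ℕ → Carrier
  pow x zero    = 1#
  pow x (suc m) = x * pow x m

  HasCardinality : ℕ → Set (c ⊔ ℓ)
  HasCardinality N = ∃ λ (enum : Fin N → Carrier) →
    (∀ i j → enum i ≈ enum j → i ≡ j) × (∀ x → ∃ λ i → enum i ≈ x)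

  InSubfield : ℕ → Carrier → Set ℓ
  InSubfield q x = pow x q ≈ x

  Tr : ℕ → ℕ → Carrier → Carrier
  Tr q zero    x = 0#
  Tr q (suc n) x = Tr q n x + pow x (q ℕ.^ n)

  KerTr : ℕ → ℕ → Carrier → Set ℓ
  KerTr q n x = Tr q n x ≈ 0#

  Permutes : (Carrier → Carrier) → (Carrier → Set ℓ) → Set (c ⊔ ℓ)
  Permutes f S =
    (∀ x → S x → S (f x)) ×
    (∀ x y → S x → S y → f x ≈ f y → x ≈ y) ×
    (∀ y → S y → ∃ λ x → S x × (f x ≈ y))

{-# OPTIONS --safe #-}

-- Since x ↦ x ^ p ^ k and x ↦ c x commute with the q-power Frobenius, f x = x ^ p ^ k - c x
-- commutes with the trace, so it maps ker(Tr) into itself; being additive and ker(Tr) being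
-- finite, it permutes ker(Tr) as soon as its only zero in ker(Tr) is 0. Suppose w ≠ 0 lies in
-- ker(Tr) with w ^ p ^ k = c w and put z = w ^ (q - 1). Then z is fixed by the p^k- and the
-- p^(rn)-power maps, hence by the p^gcd(k,r)-power map (gcd(k,n) = 1), and in particular lies in
-- F_q; so w ^ q ^ j = z ^ j w, whence z ^ n = 1, and c = w ^ (p ^ k - 1) gives c ^ e = z ^ t
-- where k = t gcd(k,r). Hence c ^ (ne) = 1, excluding case (2). In case (1), z ^ t = 1 with
-- gcd(t,n) = 1 forces z = 1, so w ∈ F_q and 0 = Tr w = n w, impossible as p ∤ n.

module Submission where

open import Defs
open import Level using (Level)
open import Data.Nat using (ℕ; _≤_; _∸_; _^_) renaming (_*_ to _*ℕ_)
open import Data.Nat.GCD using (gcd)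
open import Data.Nat.Divisibility using (_∣_)
open import Data.Nat.Primality using (Prime)
open import Data.Sum using (_⊎_)
open import Data.Product using (_×_)
open import Relation.Nullary using (¬_)
open import Relation.Binary.PropositionalEquality using (_≡_)

open import Algebra.Bundles using (Monoid; CommutativeMonoid)
open import Data.Nat as ℕ using (zero; suc; NonZero; _<_; _!)
import Data.Nat.Properties as ℕₚ
open import Data.Nat.Divisibility using (_∤_; divides; _∣?_; ∣⇒≤; ∣1⇒≡1; m∣m*n; ∣-trans)
open import Data.Nat.Primality using (euclidsLemma; ¬prime[1]; prime⇒irreducible; prime⇒nonZero)
open import Data.Nat.Coprimality
  using (Coprime; coprime-divisor; coprime⇒gcd≡1; gcd≡1⇒coprime)
open import Data.Nat.GCD using (gcd-GCD; gcd[m,n]∣m; gcd[m,n]∣n; gcd-greatest; module Bézout)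
open import Data.Nat.Combinatorics using (_C_; nCn≡1; nCk≡n!/k![n-k]!; k![n∸k]!∣n!)
open import Data.Nat.DivMod using (m/n*n≡m)
open import Data.Fin as Fin using (Fin; punchOut; punchIn; inject₁; fromℕ)
import Data.Fin.Properties as Finₚ
open import Data.Fin.Permutation using (Permutation′; permutation)
open import Data.Product using (∃; _,_; proj₁; proj₂)
open import Data.Sum using (inj₁; inj₂)
open import Data.Empty using (⊥; ⊥-elim)
open import Function.Base using (_∘_)
open import Function.Definitions using (Injective)
open import Relation.Nullary using (Dec; yes; no; contradiction)
open import Relation.Nullary.Decidable using (map′)
open import Relation.Binary.Definitions using (Decidable)
open import Relation.Binary.PropositionalEquality as ≡ using (_≢_)

-- Arithmetic

module _ where
  open import Data.Nat using (_+_; _*_)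
  open import Data.Nat.Properties using (_!*_!≢0)

  module GcdClosed {ℓ : Level} (P : ℕ → Set ℓ) (P-0 : P 0)
                   (P-+ : ∀ a b → P a → P b → P (a + b))
                   (P-cancel : ∀ a b → P (a + b) → P a → P b) where

    *-closed : ∀ s m → P m → P (s * m)
    *-closed zero    m _  = P-0
    *-closed (suc s) m Pm = P-+ m (s * m) Pm (*-closed s m Pm)

    gcd-closed : ∀ a b → P a → P b → P (gcd a b)
    gcd-closed a b Pa Pb with Bézout.identity (gcd-GCD a b)
    ... | Bézout.+- x y eq = P-cancel (y * b) (gcd a b)
            (≡.subst P (≡.sym (≡.trans (ℕₚ.+-comm (y * b) _) eq)) (*-closed x a Pa))
            (*-closed y b Pb)
    ... | Bézout.-+ x y eq = P-cancel (x * a) (gcd a b)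
            (≡.subst P (≡.sym (≡.trans (ℕₚ.+-comm (x * a) _) eq)) (*-closed y b Pb))
            (*-closed x a Pa)

    ∣-closed : ∀ {d m} → d ∣ m → P d → P m
    ∣-closed {d} (divides s ≡.refl) Pd = *-closed s d Pd

  prime∤⇒coprime : ∀ {p n} → Prime p → p ∤ n → Coprime p n
  prime∤⇒coprime p-prime p∤n (d∣p , d∣n) with prime⇒irreducible p-prime d∣p
  ... | inj₁ d≡1    = d≡1
  ... | inj₂ ≡.refl = contradiction d∣n p∤n

  prime∤m! : ∀ {p} → Prime p → ∀ m → m < p → p ∤ m !
  prime∤m! p-prime zero    _   p∣1  = ¬prime[1] (≡.subst Prime (∣1⇒≡1 p∣1) p-prime)
  prime∤m! p-prime (suc m) m<p p∣m! with euclidsLemma (suc m) (m !) p-prime p∣m!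
  ... | inj₁ p∣1+m = ℕₚ.<⇒≱ m<p (∣⇒≤ p∣1+m)
  ... | inj₂ p∣m!′ = prime∤m! p-prime m (ℕₚ.<-trans (ℕₚ.n<1+n m) m<p) p∣m!′

  nCk*[k!*[n∸k]!]≡n! : ∀ {n k} → k ≤ n → (n C k) * (k ! * (n ∸ k) !) ≡ n !
  nCk*[k!*[n∸k]!]≡n! {n} {k} k≤n =
    ≡.trans (≡.cong (_* (k ! * (n ∸ k) !)) (nCk≡n!/k![n-k]! k≤n))
            (m/n*n≡m {{k !* (n ∸ k) !≢0}} (k![n∸k]!∣n! k≤n))

  prime∣pCk : ∀ {p k} → Prime p → 0 < k → k < p → p ∣ p C k
  prime∣pCk {p@(suc p′)} {k} p-prime 0<k k<p
    with euclidsLemma (p C k) (k ! * (p ∸ k) !) p-prime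
           (≡.subst (p ∣_) (≡.sym (nCk*[k!*[n∸k]!]≡n! (ℕₚ.<⇒≤ k<p))) (m∣m*n (p′ !)))
  ... | inj₁ p∣pCk = p∣pCk
  ... | inj₂ p∣k!*[p∸k]! with euclidsLemma (k !) ((p ∸ k) !) p-prime p∣k!*[p∸k]!
  ...   | inj₁ p∣k!     = contradiction p∣k! (prime∤m! p-prime k k<p)
  ...   | inj₂ p∣[p∸k]! = contradiction p∣[p∸k]!
                            (prime∤m! p-prime (p ∸ k) (ℕₚ.∸-monoʳ-< 0<k (ℕₚ.<⇒≤ k<p)))

  geometricSum : ℕ → ℕ → ℕ
  geometricSum b zero    = 0
  geometricSum b (suc t) = b ^ t + geometricSum b t

  geometricSum-∸ : ∀ b t → .{{NonZero b}} → (b ∸ 1) * geometricSum b t ≡ b ^ t ∸ 1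
  geometricSum-∸ (suc b) t =
    ≡.trans (≡.sym (ℕₚ.m+n∸n≡m (b * geometricSum (suc b) t) 1)) (≡.cong (_∸ 1) (+1≡ t))
    where
    open ≡.≡-Reasoning
    +1≡ : ∀ t → b * geometricSum (suc b) t + 1 ≡ suc b ^ t
    +1≡ zero    = ≡.cong (_+ 1) (ℕₚ.*-zeroʳ b)
    +1≡ (suc t) = begin
      b * (B + G) + 1       ≡⟨ ≡.cong (_+ 1) (ℕₚ.*-distribˡ-+ b B G) ⟩
      b * B + b * G + 1     ≡⟨ ℕₚ.+-assoc (b * B) (b * G) 1 ⟩
      b * B + (b * G + 1)   ≡⟨ ≡.cong (b * B +_) (+1≡ t) ⟩
      b * B + B             ≡⟨ ℕₚ.+-comm (b * B) B ⟩
      B + b * B             ∎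
      where
      B = suc b ^ t
      G = geometricSum (suc b) t

  geometricSum-* : ∀ b t {e m} → .{{NonZero b}} → e * (b ∸ 1) ≡ m →
                   (b ^ t ∸ 1) * e ≡ m * geometricSum b t
  geometricSum-* b t {e} {m} e[b∸1]≡m = begin
    (b ^ t ∸ 1) * e                   ≡⟨ ≡.cong (_* e) (geometricSum-∸ b t) ⟨
    (b ∸ 1) * geometricSum b t * e    ≡⟨ ℕₚ.*-comm _ e ⟩
    e * ((b ∸ 1) * geometricSum b t)  ≡⟨ ℕₚ.*-assoc e (b ∸ 1) _ ⟨
    e * (b ∸ 1) * geometricSum b t    ≡⟨ ≡.cong (_* geometricSum b t) e[b∸1]≡m ⟩
    m * geometricSum b t              ∎
    where open ≡.≡-Reasoning

  gcd[k,r*n]∣gcd[k,r] : ∀ {k n} r → Coprime k n → gcd k (r * n) ∣ gcd k r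
  gcd[k,r*n]∣gcd[k,r] {k} {n} r k⊥n = gcd-greatest g∣k g∣r
    where
    g∣k = gcd[m,n]∣m k (r * n)
    g⊥n : Coprime (gcd k (r * n)) n
    g⊥n (i∣g , i∣n) = k⊥n (∣-trans i∣g g∣k , i∣n)
    g∣r = coprime-divisor g⊥n (≡.subst (gcd k (r * n) ∣_) (ℕₚ.*-comm r n) (gcd[m,n]∣n k (r * n)))

module _ {b ℓ : Level} (M : Monoid b ℓ) (x : Monoid.Carrier M) where
  open Monoid M
  open import Algebra.Properties.Monoid.Mult M using (×-homo-+) renaming (_×_ to _·_)

  ·≈ε-gcd : ∀ {m n} → m · x ≈ ε → n · x ≈ ε → gcd m n · x ≈ ε
  ·≈ε-gcd {m} {n} = GcdClosed.gcd-closed (λ m → m · x ≈ ε) refl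
    (λ a b aε bε → trans (×-homo-+ x a b) (trans (∙-cong aε bε) (identityˡ ε)))
    (λ a b abε aε → trans (sym (identityˡ _))
                      (trans (∙-congʳ (sym aε)) (trans (sym (×-homo-+ x a b)) abε)))
    m n

Fin-injective⇒surjective : ∀ {N} (g : Fin N → Fin N) → Injective _≡_ _≡_ g →
                           ∀ y → ∃ λ i → g i ≡ y
Fin-injective⇒surjective {suc M} g g-injective y with Finₚ.any? (λ i → g i Finₚ.≟ y)
... | yes found = found
... | no ¬found = contradiction (Finₚ.injective⇒≤ g′-injective) ℕₚ.1+n≰n
  where
  y≢g : ∀ i → y ≢ g i
  y≢g i y≡gi = ¬found (i , ≡.sym y≡gi)
  g′ : Fin (suc M) → Fin M
  g′ i = punchOut (y≢g i)
  g′-injective : Injective _≡_ _≡_ g′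
  g′-injective {i} {j} eq = g-injective (Finₚ.punchOut-injective (y≢g i) (y≢g j) eq)

Fin-injective⇒permutation : ∀ {N} (g : Fin N → Fin N) → Injective _≡_ _≡_ g → Permutation′ N
Fin-injective⇒permutation g g-injective = permutation g (proj₁ ∘ surjective)
  (λ y → proj₂ (surjective y)) (λ x → g-injective (proj₂ (surjective (g x))))
  where surjective = Fin-injective⇒surjective g g-injective

-- Powers and additive maps in a field

module _ {a ℓ : Level} (F : Field a ℓ) where
  open Field F
  import Algebra.Properties.Semiring.Exp semiring as Exp
  open import Algebra.Properties.CommutativeSemiring.Exp commutativeSemiring using (^-distrib-*)
  open import Algebra.Properties.Semiring.Mult semiring
    using (×-congʳ; ×-assoc-*; ×-assocˡ; ×1-homo-*) renaming (_×_ to _·_)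
  open import Algebra.Properties.Group +-group
    using (x∙y⁻¹≈ε⇒x≈y; x≈y⇒x∙y⁻¹≈ε; inverseˡ-unique; identityˡ-unique)
    renaming (∙-cancelˡ to +-cancelˡ)
  open import Algebra.Properties.AbelianGroup +-abelianGroup using (⁻¹-∙-comm)
  open import Algebra.Properties.CommutativeSemigroup +-commutativeSemigroup using (interchange)
  open import Algebra.Properties.CommutativeSemigroup *-commutativeSemigroup
    using () renaming (xy∙z≈zx∙y to *-xy∙z≈zx∙y)
  open import Algebra.Properties.Ring ring using (x+x≈x⇒x≈0)
  open import Relation.Binary.Reasoning.Setoid setoid

  infixr 8 _↑_
  _↑_ : Carrier → ℕ → Carrier
  x ↑ n = pow F x n

  ↑≈^ : ∀ x n → x ↑ n ≈ x Exp.^ n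
  ↑≈^ x zero    = refl
  ↑≈^ x (suc n) = *-congˡ (↑≈^ x n)

  ↑-congˡ : ∀ n {x y} → x ≈ y → x ↑ n ≈ y ↑ n
  ↑-congˡ n {x} {y} x≈y = trans (↑≈^ x n) (trans (Exp.^-congˡ n x≈y) (sym (↑≈^ y n)))

  ↑-homo-* : ∀ x m n → x ↑ (m ℕ.+ n) ≈ x ↑ m * x ↑ n
  ↑-homo-* x m n = trans (↑≈^ x (m ℕ.+ n))
    (trans (Exp.^-homo-* x m n) (sym (*-cong (↑≈^ x m) (↑≈^ x n))))

  ↑-assocʳ : ∀ x m n → (x ↑ m) ↑ n ≈ x ↑ (m ℕ.* n)
  ↑-assocʳ x m n = trans (↑-congˡ n (↑≈^ x m))
    (trans (↑≈^ (x Exp.^ m) n) (trans (Exp.^-assocʳ x m n) (sym (↑≈^ x (m ℕ.* n)))))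

  ↑-comm : ∀ x m n → (x ↑ m) ↑ n ≈ (x ↑ n) ↑ m
  ↑-comm x m n = trans (↑-assocʳ x m n)
    (trans (reflexive (≡.cong (x ↑_) (ℕₚ.*-comm m n))) (sym (↑-assocʳ x n m)))

  ↑-distrib-* : ∀ x y n → (x * y) ↑ n ≈ x ↑ n * y ↑ n
  ↑-distrib-* x y n = trans (↑≈^ (x * y) n)
    (trans (^-distrib-* x y n) (sym (*-cong (↑≈^ x n) (↑≈^ y n))))

  1↑n≈1 : ∀ n → 1# ↑ n ≈ 1#
  1↑n≈1 zero    = refl
  1↑n≈1 (suc n) = trans (*-identityˡ _) (1↑n≈1 n)

  ↑-pred : ∀ x m → .{{NonZero m}} → x ↑ m ≈ x * x ↑ (m ∸ 1)
  ↑-pred x (suc m) = refl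

  ↑-fixed-iterate : ∀ {x e} → x ↑ e ≈ x → ∀ m → x ↑ (e ^ m) ≈ x
  ↑-fixed-iterate {x} {e} xᵉ≈x zero    = *-identityʳ x
  ↑-fixed-iterate {x} {e} xᵉ≈x (suc m) = begin
    x ↑ (e ℕ.* e ^ m)    ≈⟨ ↑-assocʳ x e (e ^ m) ⟨
    (x ↑ e) ↑ (e ^ m)    ≈⟨ ↑-congˡ (e ^ m) xᵉ≈x ⟩
    x ↑ (e ^ m)          ≈⟨ ↑-fixed-iterate xᵉ≈x m ⟩
    x                    ∎

  ↑≈1-gcd : ∀ {x m n} → x ↑ m ≈ 1# → x ↑ n ≈ 1# → x ↑ gcd m n ≈ 1#
  ↑≈1-gcd {x} {m} {n} xᵐ≈1 xⁿ≈1 = trans (↑≈^ x (gcd m n))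
    (·≈ε-gcd *-monoid x {m} {n} (trans (sym (↑≈^ x m)) xᵐ≈1) (trans (sym (↑≈^ x n)) xⁿ≈1))

  ↑-period-+ : ∀ {x} b m n → x ↑ (b ^ m) ≈ x → x ↑ (b ^ n) ≈ x → x ↑ (b ^ (m ℕ.+ n)) ≈ x
  ↑-period-+ {x} b m n x↑bᵐ≈x x↑bⁿ≈x = begin
    x ↑ (b ^ (m ℕ.+ n))      ≡⟨ ≡.cong (x ↑_) (ℕₚ.^-distribˡ-+-* b m n) ⟩
    x ↑ (b ^ m ℕ.* b ^ n)    ≈⟨ ↑-assocʳ x (b ^ m) (b ^ n) ⟨
    (x ↑ (b ^ m)) ↑ (b ^ n)  ≈⟨ ↑-congˡ (b ^ n) x↑bᵐ≈x ⟩
    x ↑ (b ^ n)              ≈⟨ x↑bⁿ≈x ⟩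
    x                        ∎

  ↑-period-cancel : ∀ {x} b m n → x ↑ (b ^ (m ℕ.+ n)) ≈ x → x ↑ (b ^ m) ≈ x → x ↑ (b ^ n) ≈ x
  ↑-period-cancel {x} b m n x↑bᵐ⁺ⁿ≈x x↑bᵐ≈x = begin
    x ↑ (b ^ n)              ≈⟨ ↑-congˡ (b ^ n) x↑bᵐ≈x ⟨
    (x ↑ (b ^ m)) ↑ (b ^ n)  ≈⟨ ↑-assocʳ x (b ^ m) (b ^ n) ⟩
    x ↑ (b ^ m ℕ.* b ^ n)    ≡⟨ ≡.cong (x ↑_) (ℕₚ.^-distribˡ-+-* b m n) ⟨
    x ↑ (b ^ (m ℕ.+ n))      ≈⟨ x↑bᵐ⁺ⁿ≈x ⟩
    x                        ∎

  module ↑-Periods (x : Carrier) (b : ℕ) =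
    GcdClosed (λ m → x ↑ (b ^ m) ≈ x) (*-identityʳ x) (↑-period-+ b) (↑-period-cancel b)

  ^·1≈·1↑ : ∀ p m → (p ^ m) · 1# ≈ (p · 1#) ↑ m
  ^·1≈·1↑ p zero    = +-identityʳ 1#
  ^·1≈·1↑ p (suc m) = trans (×1-homo-* p (p ^ m)) (*-congˡ (^·1≈·1↑ p m))

  *-cancelʳ : ∀ {x y u} → ¬ u ≈ 0# → x * u ≈ y * u → x ≈ y
  *-cancelʳ {x} {y} {u} u≉0 xu≈yu with inverse u u≉0
  ... | v , uv≈1 = begin
    x            ≈⟨ *-identityʳ x ⟨
    x * 1#       ≈⟨ *-congˡ uv≈1 ⟨
    x * (u * v)  ≈⟨ *-assoc x u v ⟨
    x * u * v    ≈⟨ *-congʳ xu≈yu ⟩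
    y * u * v    ≈⟨ *-assoc y u v ⟩
    y * (u * v)  ≈⟨ *-congˡ uv≈1 ⟩
    y * 1#       ≈⟨ *-identityʳ y ⟩
    y            ∎

  *-cancelˡ : ∀ {x y u} → ¬ u ≈ 0# → u * x ≈ u * y → x ≈ y
  *-cancelˡ {x} {y} {u} u≉0 ux≈uy =
    *-cancelʳ u≉0 (trans (*-comm x u) (trans ux≈uy (*-comm u y)))

  *-≉0 : ∀ {x y} → ¬ x ≈ 0# → ¬ y ≈ 0# → ¬ x * y ≈ 0#
  *-≉0 {x} {y} x≉0 y≉0 xy≈0 =
    y≉0 (*-cancelʳ x≉0 (trans (*-comm y x) (trans xy≈0 (sym (zeroˡ x)))))

  ↑-≉0 : ∀ {x} n → ¬ x ≈ 0# → ¬ x ↑ n ≈ 0#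
  ↑-≉0 zero    x≉0 = 1≉0
  ↑-≉0 (suc n) x≉0 = *-≉0 x≉0 (↑-≉0 n x≉0)

  x-y≈0⇒x≈y : ∀ {x y} → x - y ≈ 0# → x ≈ y
  x-y≈0⇒x≈y = x∙y⁻¹≈ε⇒x≈y _ _

  freshman's-dream : ∀ n → 0 < n → (∀ k w → 0 < k → k < n → (n C k) · w ≈ 0#) →
                     ∀ x y → (x + y) ↑ n ≈ x ↑ n + y ↑ n
  freshman's-dream (suc m) _ inner≈0 x y = begin
    (x + y) ↑ suc m                                     ≈⟨ ↑≈^ (x + y) (suc m) ⟩
    (x + y) Exp.^ suc m                                 ≈⟨ Binomial.theorem (suc m) x y ⟩
    term Fin.zero + sum (term ∘ Fin.suc)                ≈⟨ +-congˡ (sum-init-last (term ∘ Fin.suc)) ⟩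
    term Fin.zero + (sum (term ∘ Fin.suc ∘ inject₁) + term (Fin.suc (fromℕ m)))
                                                        ≈⟨ +-congˡ (+-cong inner-terms≈0 last-term) ⟩
    term Fin.zero + (0# + x Exp.^ suc m)                ≈⟨ +-cong first-term (+-identityˡ _) ⟩
    y Exp.^ suc m + x Exp.^ suc m                       ≈⟨ +-comm _ _ ⟩
    x Exp.^ suc m + y Exp.^ suc m                       ≈⟨ +-cong (↑≈^ x (suc m)) (↑≈^ y (suc m)) ⟨
    x ↑ suc m + y ↑ suc m                               ∎
    where
    open import Algebra.Properties.Semiring.Sum semiring
      using (sum; sum-init-last; sum-cong-≋; sum-replicate-zero)
    import Algebra.Properties.CommutativeSemiring.Binomial commutativeSemiring as Binomial

    term = Binomial.binomialTerm x y (suc m)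

    first-term : term Fin.zero ≈ y Exp.^ suc m
    first-term = trans (+-identityʳ _) (*-identityˡ _)

    inner-terms≈0 : sum {m} (term ∘ Fin.suc ∘ inject₁) ≈ 0#
    inner-terms≈0 = trans (sum-cong-≋ (λ j → inner≈0 _ _ (ℕ.s≤s ℕ.z≤n)
        (ℕ.s≤s (≡.subst (_< m) (≡.sym (Finₚ.toℕ-inject₁ j)) (Finₚ.toℕ<n j)))))
      (sum-replicate-zero m)

    last-term : term (Fin.suc (fromℕ m)) ≈ x Exp.^ suc m
    last-term rewrite Finₚ.toℕ-fromℕ m | nCn≡1 (suc m) | ℕₚ.n∸n≡0 m =
      trans (+-identityʳ _) (*-identityʳ _)

  record IsAdditive (f : Carrier → Carrier) : Set (a Level.⊔ ℓ) where
    field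
      cong : ∀ {x y} → x ≈ y → f x ≈ f y
      homo : ∀ x y → f (x + y) ≈ f x + f y

    0-homo : f 0# ≈ 0#
    0-homo = x+x≈x⇒x≈0 (f 0#) (trans (sym (homo 0# 0#)) (cong (+-identityˡ 0#)))

    -‿homo : ∀ x → f (- x) ≈ - f x
    -‿homo x = inverseˡ-unique (f (- x)) (f x)
      (trans (sym (homo (- x) x)) (trans (cong (-‿inverseˡ x)) 0-homo))

    -‿homo₂ : ∀ x y → f (x - y) ≈ f x - f y
    -‿homo₂ x y = trans (homo x (- y)) (+-congˡ (-‿homo y))

  open IsAdditive

  *-additive : ∀ c → IsAdditive (c *_)
  *-additive c = record { cong = *-congˡ ; homo = distribˡ c }

  +-additive : ∀ {f g} → IsAdditive f → IsAdditive g → IsAdditive (λ x → f x + g x)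
  +-additive {f} {g} f-additive g-additive = record
    { cong = λ x≈y → +-cong (cong f-additive x≈y) (cong g-additive x≈y)
    ; homo = λ x y → trans (+-cong (homo f-additive x y) (homo g-additive x y))
                           (interchange (f x) (f y) (g x) (g y))
    }

  -‿additive : ∀ {f g} → IsAdditive f → IsAdditive g → IsAdditive (λ x → f x - g x)
  -‿additive {f} {g} f-additive g-additive = +-additive f-additive (record
    { cong = λ x≈y → -‿cong (cong g-additive x≈y)
    ; homo = λ x y → trans (-‿cong (homo g-additive x y)) (sym (⁻¹-∙-comm (g x) (g y)))
    })

  -- Finite fields

  module FiniteField {N : ℕ} (card : HasCardinality F N) where

    enum : Fin N → Carrier
    enum = proj₁ card

    enum-injective : ∀ {i j} → enum i ≈ enum j → i ≡ j
    enum-injective = proj₁ (proj₂ card) _ _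

    index : Carrier → Fin N
    index x = proj₁ (proj₂ (proj₂ card) x)

    enum-index : ∀ x → enum (index x) ≈ x
    enum-index x = proj₂ (proj₂ (proj₂ card) x)

    index-injective : ∀ {x y} → index x ≡ index y → x ≈ y
    index-injective {x} {y} eq =
      trans (sym (enum-index x)) (trans (reflexive (≡.cong enum eq)) (enum-index y))

    index-cong : ∀ {x y} → x ≈ y → index x ≡ index y
    index-cong {x} {y} x≈y = enum-injective (trans (enum-index x) (trans x≈y (sym (enum-index y))))

    _≟_ : Decidable _≈_
    x ≟ y = map′ index-injective index-cong (index x Finₚ.≟ index y)

    ↑≈0⇒≈0 : ∀ {x} n → x ↑ n ≈ 0# → x ≈ 0#
    ↑≈0⇒≈0 {x} n xⁿ≈0 with x ≟ 0#
    ... | yes x≈0 = x≈0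
    ... | no  x≉0 = contradiction xⁿ≈0 (↑-≉0 n x≉0)

    reindex-injective : {g : Carrier → Carrier} → (∀ {x y} → g x ≈ g y → x ≈ y) →
                        Injective _≡_ _≡_ (index ∘ g ∘ enum)
    reindex-injective g-injective eq = enum-injective (g-injective (index-injective eq))

    injective⇒surjective : (g : Carrier → Carrier) → (∀ {x y} → g x ≈ g y → x ≈ y) →
                           ∀ y → ∃ λ x → g x ≈ y
    injective⇒surjective g g-injective y =
      let i , gi≡y = Fin-injective⇒surjective _ (reindex-injective g-injective) (index y)
      in enum i , index-injective gi≡y

    module _ {b ℓ′ : Level} (M : CommutativeMonoid b ℓ′) where
      private module M = CommutativeMonoid M
      open import Algebra.Properties.CommutativeMonoid.Sum M
        using () renaming (sum to ∑; sum-permute to ∑-permute; sum-cong-≋ to ∑-cong-≋)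

      ∑-injective : (u : Carrier → M.Carrier) → (∀ {x y} → x ≈ y → u x M.≈ u y) →
                    (g : Carrier → Carrier) → (∀ {x y} → g x ≈ g y → x ≈ y) →
                    ∑ (u ∘ g ∘ enum) M.≈ ∑ (u ∘ enum)
      ∑-injective u u-cong g g-injective = M.sym (M.trans
        (∑-permute (u ∘ enum) (Fin-injective⇒permutation _ (reindex-injective g-injective)))
        (∑-cong-≋ (λ i → u-cong (enum-index (g (enum i))))))

    open import Algebra.Properties.CommutativeMonoid.Sum +-commutativeMonoid
      using (∑-distrib-+; sum-replicate) renaming (sum to ∑)

    characteristic : N · 1# ≈ 0#
    characteristic = identityˡ-unique (N · 1#) (∑ enum) (begin
      N · 1# + ∑ enum                 ≈⟨ +-congʳ (sum-replicate N) ⟨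
      ∑ {N} (λ _ → 1#) + ∑ enum       ≈⟨ ∑-distrib-+ (λ _ → 1#) enum ⟨
      ∑ (λ i → 1# + enum i)           ≈⟨ ∑-injective +-commutativeMonoid (λ x → x) (λ x≈y → x≈y)
                                           (1# +_) (+-cancelˡ 1# _ _) ⟩
      ∑ enum                          ∎)

    N≡pᵐ⇒p·1≈0 : ∀ p m → N ≡ p ^ m → p · 1# ≈ 0#
    N≡pᵐ⇒p·1≈0 p m N≡pᵐ =
      ↑≈0⇒≈0 m (trans (sym (^·1≈·1↑ p m)) (≡.subst (λ N → N · 1# ≈ 0#) N≡pᵐ characteristic))

    module _ {ℓ′ : Level} (S : Carrier → Set ℓ′) (S? : ∀ x → Dec (S x))
             (S-resp : ∀ {x y} → x ≈ y → S x → S y)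
             (f : Carrier → Carrier) (f-into : ∀ x → S x → S (f x))
             (f-injective : ∀ x y → S x → S y → f x ≈ f y → x ≈ y) where

      private
        f-or-id : Carrier → Carrier
        f-or-id x with S? x
        ... | yes _ = f x
        ... | no  _ = x

        f-or-id-injective : ∀ {x y} → f-or-id x ≈ f-or-id y → x ≈ y
        f-or-id-injective {x} {y} eq with S? x | S? y
        ... | yes Sx | yes Sy = f-injective x y Sx Sy eq
        ... | yes Sx | no ¬Sy = contradiction (S-resp eq (f-into x Sx)) ¬Sy
        ... | no ¬Sx | yes Sy = contradiction (S-resp (sym eq) (f-into y Sy)) ¬Sx
        ... | no _   | no _   = eq

      injectiveOn⇒surjectiveOn : ∀ y → S y → ∃ λ x → S x × f x ≈ y
      injectiveOn⇒surjectiveOn y Sy with injective⇒surjective f-or-id f-or-id-injective y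
      ... | x , fx≈y with S? x
      ...   | yes Sx = x , Sx , fx≈y
      ...   | no ¬Sx = contradiction (S-resp (sym fx≈y) Sy) ¬Sx

  module Fermat {M : ℕ} (card : HasCardinality F (suc M)) where
    open FiniteField card
    open import Algebra.Properties.CommutativeMonoid.Sum *-commutativeMonoid
      using (sum-remove; ∑-distrib-+; sum-replicate; sum-cong-≋) renaming (sum to ∏)

    nz : Carrier → Carrier
    nz x with x ≟ 0#
    ... | yes _ = 1#
    ... | no  _ = x

    nz-≉0 : ∀ x → ¬ nz x ≈ 0#
    nz-≉0 x with x ≟ 0#
    ... | yes _   = 1≉0
    ... | no  x≉0 = x≉0

    nz-cong : ∀ {x y} → x ≈ y → nz x ≈ nz y
    nz-cong {x} {y} x≈y with x ≟ 0# | y ≟ 0#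
    ... | yes _   | yes _   = refl
    ... | yes x≈0 | no  y≉0 = contradiction (trans (sym x≈y) x≈0) y≉0
    ... | no  x≉0 | yes y≈0 = contradiction (trans x≈y y≈0) x≉0
    ... | no  _   | no  _   = x≈y

    nz-≈0 : ∀ {x} → x ≈ 0# → nz x ≈ 1#
    nz-≈0 {x} x≈0 with x ≟ 0#
    ... | yes _   = refl
    ... | no  x≉0 = contradiction x≈0 x≉0

    nz-≉0-id : ∀ {x} → ¬ x ≈ 0# → nz x ≈ x
    nz-≉0-id {x} x≉0 with x ≟ 0#
    ... | yes x≈0 = contradiction x≈0 x≉0
    ... | no  _   = refl

    ∏-≉0 : ∀ {m} (v : Fin m → Carrier) → (∀ i → ¬ v i ≈ 0#) → ¬ ∏ v ≈ 0#
    ∏-≉0 {zero}  v _    = 1≉0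
    ∏-≉0 {suc m} v v≉0 = *-≉0 (v≉0 Fin.zero) (∏-≉0 (v ∘ Fin.suc) (v≉0 ∘ Fin.suc))

    -- x ↦ b x permutes F, so ∏ₓ nz (b x) = ∏ₓ nz x, and off x = 0 the factors differ by b.
    ↑-order : ∀ {b} → ¬ b ≈ 0# → b ↑ M ≈ 1#
    ↑-order {b} b≉0 = *-cancelʳ (∏-≉0 (nz ∘ v) (nz-≉0 ∘ v)) (begin
      b ↑ M * ∏ (nz ∘ v)                  ≈⟨ *-congʳ (trans (↑≈^ b M) (sym (sum-replicate M))) ⟩
      ∏ {M} (λ _ → b) * ∏ (nz ∘ v)        ≈⟨ ∑-distrib-+ (λ _ → b) (nz ∘ v) ⟨
      ∏ (λ j → b * nz (v j))              ≈⟨ sum-cong-≋ (λ j → trans (*-congˡ (nz-≉0-id (v≉0 j)))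
                                               (sym (nz-≉0-id (*-≉0 b≉0 (v≉0 j))))) ⟩
      ∏ (λ j → nz (b * v j))              ≈⟨ *-identityˡ _ ⟨
      1# * ∏ (λ j → nz (b * v j))         ≈⟨ *-congʳ (nz-≈0 (trans (*-congˡ (enum-index 0#)) (zeroʳ b))) ⟨
      nz (b * enum i₀) * ∏ (λ j → nz (b * v j))
                                          ≈⟨ sum-remove {i = i₀} (λ i → nz (b * enum i)) ⟨
      ∏ (λ i → nz (b * enum i))           ≈⟨ ∑-injective *-commutativeMonoid nz nz-cong (b *_) (*-cancelˡ b≉0) ⟩
      ∏ (nz ∘ enum)                       ≈⟨ sum-remove {i = i₀} (nz ∘ enum) ⟩
      nz (enum i₀) * ∏ (nz ∘ v)           ≈⟨ *-congʳ (nz-≈0 (enum-index 0#)) ⟩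
      1# * ∏ (nz ∘ v)                     ∎)
      where
      i₀ = index 0#
      v : Fin M → Carrier
      v j = enum (punchIn i₀ j)
      v≉0 : ∀ j → ¬ v j ≈ 0#
      v≉0 j vj≈0 = Finₚ.punchInᵢ≢i i₀ j (enum-injective (trans vj≈0 (sym (enum-index 0#))))

    fermat-suc : ∀ x → x ↑ suc M ≈ x
    fermat-suc x with x ≟ 0#
    ... | yes x≈0 = trans (trans (*-congʳ x≈0) (zeroˡ _)) (sym x≈0)
    ... | no  x≉0 = trans (*-congˡ (↑-order x≉0)) (*-identityʳ x)

  fermat : ∀ {N} → HasCardinality F N → ∀ x → x ↑ N ≈ x
  fermat {zero}  (_ , _ , onto) x with onto x
  ... | () , _
  fermat {suc M} card = Fermat.fermat-suc card

  module Frobenius {p : ℕ} (p-prime : Prime p) (char : p · 1# ≈ 0#) where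

    ·-char-multiple : ∀ {m} → p ∣ m → ∀ w → m · w ≈ 0#
    ·-char-multiple (divides s ≡.refl) w = begin
      (s ℕ.* p) · w      ≡⟨ ≡.cong (_· w) (ℕₚ.*-comm s p) ⟩
      (p ℕ.* s) · w      ≈⟨ ×-assocˡ w p s ⟨
      p · (s · w)        ≈⟨ ×-congʳ p (*-identityˡ (s · w)) ⟨
      p · (1# * s · w)   ≈⟨ ×-assoc-* p 1# (s · w) ⟨
      (p · 1#) * s · w   ≈⟨ *-congʳ char ⟩
      0# * s · w         ≈⟨ zeroˡ _ ⟩
      0#                 ∎

    m·1≈0⇒p∣m : ∀ {m} → m · 1# ≈ 0# → p ∣ m
    m·1≈0⇒p∣m {m} m·1≈0 with p ∣? m
    ... | yes p∣m = p∣m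
    ... | no  p∤m = contradiction
      (trans (sym (+-identityʳ 1#)) (≡.subst (λ d → d · 1# ≈ 0#) (coprime⇒gcd≡1 (prime∤⇒coprime p-prime p∤m))
        (·≈ε-gcd +-monoid 1# {p} {m} char m·1≈0)))
      1≉0

    frobenius-additive : ∀ j → IsAdditive (_↑ (p ^ j))
    frobenius-additive j = record { cong = ↑-congˡ (p ^ j) ; homo = homo′ j }
      where
      ↑p-homo : ∀ x y → (x + y) ↑ p ≈ x ↑ p + y ↑ p
      ↑p-homo = freshman's-dream p (ℕ.>-nonZero⁻¹ p {{prime⇒nonZero p-prime}})
        (λ k w 0<k k<p → ·-char-multiple (prime∣pCk p-prime 0<k k<p) w)

      homo′ : ∀ j x y → (x + y) ↑ (p ^ j) ≈ x ↑ (p ^ j) + y ↑ (p ^ j)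
      homo′ zero    x y = trans (*-identityʳ _) (sym (+-cong (*-identityʳ x) (*-identityʳ y)))
      homo′ (suc j) x y = begin
        (x + y) ↑ (p ℕ.* p ^ j)               ≈⟨ ↑-assocʳ (x + y) p (p ^ j) ⟨
        ((x + y) ↑ p) ↑ (p ^ j)               ≈⟨ ↑-congˡ (p ^ j) (↑p-homo x y) ⟩
        (x ↑ p + y ↑ p) ↑ (p ^ j)             ≈⟨ homo′ j (x ↑ p) (y ↑ p) ⟩
        (x ↑ p) ↑ (p ^ j) + (y ↑ p) ↑ (p ^ j) ≈⟨ +-cong (↑-assocʳ x p (p ^ j)) (↑-assocʳ y p (p ^ j)) ⟩
        x ↑ (p ℕ.* p ^ j) + y ↑ (p ℕ.* p ^ j) ∎

  module Trace (q : ℕ) where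

    Tr-additive : (∀ m → IsAdditive (_↑ (q ^ m))) → ∀ m → IsAdditive (Tr F q m)
    Tr-additive qᵐ-additive zero    =
      record { cong = λ _ → refl ; homo = λ _ _ → sym (+-identityˡ 0#) }
    Tr-additive qᵐ-additive (suc m) = +-additive (Tr-additive qᵐ-additive m) (qᵐ-additive m)

    Tr-comm : ∀ {g} → IsAdditive g → (∀ m x → g (x ↑ (q ^ m)) ≈ g x ↑ (q ^ m)) →
              ∀ m x → Tr F q m (g x) ≈ g (Tr F q m x)
    Tr-comm g-additive g-comm zero    x = sym (0-homo g-additive)
    Tr-comm g-additive g-comm (suc m) x = trans
      (+-cong (Tr-comm g-additive g-comm m x) (sym (g-comm m x))) (sym (homo g-additive _ _))

    Tr-fixed : ∀ {x} → x ↑ q ≈ x → ∀ m → Tr F q m x ≈ m · x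
    Tr-fixed x∈Fq zero    = refl
    Tr-fixed x∈Fq (suc m) =
      trans (+-cong (Tr-fixed x∈Fq m) (↑-fixed-iterate x∈Fq m)) (+-comm _ _)

  -- The map x ↦ x ^ p ^ k - c x on ker(Tr)

  module TraceKernel (p r n k : ℕ) (p-prime : Prime p) (card : HasCardinality F ((p ^ r) ^ n))
                     (c : Carrier) (c∈Fq : InSubfield F (p ^ r) c) where

    instance
      p≢0 : NonZero p
      p≢0 = prime⇒nonZero p-prime

    q : ℕ
    q = p ^ r

    open FiniteField card using (_≟_; N≡pᵐ⇒p·1≈0; injectiveOn⇒surjectiveOn)

    char : p · 1# ≈ 0#
    char = N≡pᵐ⇒p·1≈0 p (r ℕ.* n) (ℕₚ.^-*-assoc p r n)

    open Frobenius p-prime char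
    open Trace q

    qᵐ-additive : ∀ m → IsAdditive (_↑ (q ^ m))
    qᵐ-additive m = ≡.subst (λ e → IsAdditive (_↑ e)) (≡.sym (ℕₚ.^-*-assoc p r m))
                            (frobenius-additive (r ℕ.* m))

    Ker : Carrier → Set ℓ
    Ker = KerTr F q n

    Ker-resp : ∀ {x y} → x ≈ y → Ker x → Ker y
    Ker-resp x≈y = trans (cong (Tr-additive qᵐ-additive n) (sym x≈y))

    Ker-‿ : ∀ {x y} → Ker x → Ker y → Ker (x - y)
    Ker-‿ {x} {y} x∈Ker y∈Ker = trans (-‿homo₂ (Tr-additive qᵐ-additive n) x y)
      (trans (+-cong x∈Ker (-‿cong y∈Ker)) (-‿inverseʳ 0#))

    f : Carrier → Carrier
    f x = x ↑ (p ^ k) - c * x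

    f-additive : IsAdditive f
    f-additive = -‿additive (frobenius-additive k) (*-additive c)

    f-comm-qᵐ : ∀ m x → f (x ↑ (q ^ m)) ≈ f x ↑ (q ^ m)
    f-comm-qᵐ m x = sym (begin
      (x ↑ P - c * x) ↑ Q             ≈⟨ -‿homo₂ (qᵐ-additive m) _ _ ⟩
      (x ↑ P) ↑ Q - (c * x) ↑ Q       ≈⟨ +-cong (↑-comm x P Q) (-‿cong (↑-distrib-* c x Q)) ⟩
      (x ↑ Q) ↑ P - c ↑ Q * x ↑ Q     ≈⟨ +-congˡ (-‿cong (*-congʳ (↑-fixed-iterate c∈Fq m))) ⟩
      (x ↑ Q) ↑ P - c * x ↑ Q         ∎)
      where
      P = p ^ k
      Q = q ^ m

    f-into-Ker : ∀ x → Ker x → Ker (f x)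
    f-into-Ker x x∈Ker = trans (Tr-comm f-additive f-comm-qᵐ n x)
      (trans (cong f-additive x∈Ker) (0-homo f-additive))

    module _ (Ker∩f⁻¹0≈0 : ∀ w → Ker w → f w ≈ 0# → w ≈ 0#) where

      f-injectiveOn-Ker : ∀ x y → Ker x → Ker y → f x ≈ f y → x ≈ y
      f-injectiveOn-Ker x y x∈Ker y∈Ker fx≈fy = x-y≈0⇒x≈y (Ker∩f⁻¹0≈0 (x - y)
        (Ker-‿ x∈Ker y∈Ker) (trans (-‿homo₂ f-additive x y) (x≈y⇒x∙y⁻¹≈ε fx≈fy)))

      f-permutes-Ker : Permutes F f Ker
      f-permutes-Ker = f-into-Ker , f-injectiveOn-Ker ,
        injectiveOn⇒surjectiveOn Ker (λ x → Tr F q n x ≟ 0#) Ker-resp f f-into-Ker f-injectiveOn-Ker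

    module Eigenvector (k⊥n : Coprime k n) (e : ℕ) (e-def : e *ℕ (p ^ gcd k r ∸ 1) ≡ q ∸ 1)
                       {w : Carrier} (w≉0 : ¬ w ≈ 0#) (w↑pᵏ≈cw : w ↑ (p ^ k) ≈ c * w) where

      z : Carrier
      z = w ↑ (q ∸ 1)

      w↑q≈wz : w ↑ q ≈ w * z
      w↑q≈wz = ↑-pred w q {{ℕₚ.m^n≢0 p r}}

      c≉0 : ¬ c ≈ 0#
      c≉0 c≈0 = ↑-≉0 (p ^ k) w≉0 (trans w↑pᵏ≈cw (trans (*-congʳ c≈0) (zeroˡ w)))

      c≈w↑[pᵏ∸1] : c ≈ w ↑ (p ^ k ∸ 1)
      c≈w↑[pᵏ∸1] = *-cancelʳ w≉0 (trans (sym w↑pᵏ≈cw)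
        (trans (↑-pred w (p ^ k) {{ℕₚ.m^n≢0 p k}}) (*-comm w _)))

      z↑pᵏ≈z : z ↑ (p ^ k) ≈ z
      z↑pᵏ≈z = *-cancelˡ (*-≉0 c≉0 w≉0) (begin
        (c * w) * z ↑ P          ≈⟨ *-congʳ w↑pᵏ≈cw ⟨
        w ↑ P * z ↑ P            ≈⟨ ↑-distrib-* w z P ⟨
        (w * z) ↑ P              ≈⟨ ↑-congˡ P w↑q≈wz ⟨
        (w ↑ q) ↑ P              ≈⟨ ↑-comm w q P ⟩
        (w ↑ P) ↑ q              ≈⟨ ↑-congˡ q w↑pᵏ≈cw ⟩
        (c * w) ↑ q              ≈⟨ ↑-distrib-* c w q ⟩
        c ↑ q * w ↑ q            ≈⟨ *-cong c∈Fq w↑q≈wz ⟩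
        c * (w * z)              ≈⟨ *-assoc c w z ⟨
        (c * w) * z              ∎)
        where P = p ^ k

      z↑p^[rn]≈z : z ↑ (p ^ (r ℕ.* n)) ≈ z
      z↑p^[rn]≈z = trans (reflexive (≡.cong (z ↑_) (≡.sym (ℕₚ.^-*-assoc p r n)))) (fermat card z)

      z↑p^gcd[k,r]≈z : z ↑ (p ^ gcd k r) ≈ z
      z↑p^gcd[k,r]≈z = ↑-Periods.∣-closed z p (gcd[k,r*n]∣gcd[k,r] r k⊥n)
        (↑-Periods.gcd-closed z p k (r ℕ.* n) z↑pᵏ≈z z↑p^[rn]≈z)

      z∈Fq : z ↑ q ≈ z
      z∈Fq = ↑-Periods.∣-closed z p (gcd[m,n]∣n k r) z↑p^gcd[k,r]≈z

      w↑qʲ≈zʲw : ∀ j → w ↑ (q ^ j) ≈ z ↑ j * w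
      w↑qʲ≈zʲw zero    = trans (*-identityʳ w) (sym (*-identityˡ w))
      w↑qʲ≈zʲw (suc j) = begin
        w ↑ (q ℕ.* q ^ j)            ≈⟨ ↑-assocʳ w q (q ^ j) ⟨
        (w ↑ q) ↑ (q ^ j)            ≈⟨ ↑-congˡ (q ^ j) w↑q≈wz ⟩
        (w * z) ↑ (q ^ j)            ≈⟨ ↑-distrib-* w z (q ^ j) ⟩
        w ↑ (q ^ j) * z ↑ (q ^ j)    ≈⟨ *-cong (w↑qʲ≈zʲw j) (↑-fixed-iterate z∈Fq j) ⟩
        (z ↑ j * w) * z              ≈⟨ *-xy∙z≈zx∙y (z ↑ j) w z ⟩
        (z * z ↑ j) * w              ∎

      zⁿ≈1 : z ↑ n ≈ 1#
      zⁿ≈1 = *-cancelʳ w≉0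
        (trans (sym (w↑qʲ≈zʲw n)) (trans (fermat card w) (sym (*-identityˡ w))))

      t : ℕ
      t = _∣_.quotient (gcd[m,n]∣m k r)

      k≡gcd[k,r]*t : k ≡ gcd k r ℕ.* t
      k≡gcd[k,r]*t = ≡.trans (_∣_.equality (gcd[m,n]∣m k r)) (ℕₚ.*-comm t (gcd k r))

      -- With P = p ^ gcd(k,r) and p ^ k = P ^ t, the exponent (p ^ k - 1) e factors as
      -- (q - 1)(1 + P + ⋯ + P ^ (t-1)), and z is fixed by x ↦ x ^ P.
      cᵉ≈zᵗ : c ↑ e ≈ z ↑ t
      cᵉ≈zᵗ = begin
        c ↑ e                                      ≈⟨ ↑-congˡ e c≈w↑[pᵏ∸1] ⟩
        (w ↑ (p ^ k ∸ 1)) ↑ e                      ≈⟨ ↑-assocʳ w (p ^ k ∸ 1) e ⟩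
        w ↑ ((p ^ k ∸ 1) ℕ.* e)                    ≡⟨ ≡.cong (λ m → w ↑ ((m ∸ 1) ℕ.* e)) pᵏ≡Pᵗ ⟩
        w ↑ ((P ^ t ∸ 1) ℕ.* e)                    ≡⟨ ≡.cong (w ↑_) (geometricSum-* P t
                                                        {{ℕₚ.m^n≢0 p (gcd k r)}} e-def) ⟩
        w ↑ ((q ∸ 1) ℕ.* geometricSum P t)         ≈⟨ ↑-assocʳ w (q ∸ 1) (geometricSum P t) ⟨
        z ↑ geometricSum P t                       ≈⟨ z↑geometricSum t ⟩
        z ↑ t                                      ∎
        where
        P = p ^ gcd k r

        pᵏ≡Pᵗ : p ^ k ≡ P ^ t
        pᵏ≡Pᵗ = ≡.trans (≡.cong (p ^_) k≡gcd[k,r]*t) (≡.sym (ℕₚ.^-*-assoc p (gcd k r) t))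

        z↑geometricSum : ∀ j → z ↑ geometricSum P j ≈ z ↑ j
        z↑geometricSum zero    = refl
        z↑geometricSum (suc j) = trans (↑-homo-* z (P ^ j) (geometricSum P j))
          (*-cong (↑-fixed-iterate z↑p^gcd[k,r]≈z j) (z↑geometricSum j))

      c↑ne≈1 : c ↑ (n ℕ.* e) ≈ 1#
      c↑ne≈1 = begin
        c ↑ (n ℕ.* e)    ≈⟨ ↑-assocʳ c n e ⟨
        (c ↑ n) ↑ e      ≈⟨ ↑-comm c n e ⟩
        (c ↑ e) ↑ n      ≈⟨ ↑-congˡ n cᵉ≈zᵗ ⟩
        (z ↑ t) ↑ n      ≈⟨ ↑-comm z t n ⟩
        (z ↑ n) ↑ t      ≈⟨ ↑-congˡ t zⁿ≈1 ⟩
        1# ↑ t           ≈⟨ 1↑n≈1 t ⟩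
        1#               ∎

      cᵉ≈1⇒p∣n : Ker w → c ↑ e ≈ 1# → p ∣ n
      cᵉ≈1⇒p∣n w∈Ker cᵉ≈1 = m·1≈0⇒p∣m (*-cancelʳ w≉0 (begin
        n · 1# * w      ≈⟨ ×-assoc-* n 1# w ⟩
        n · (1# * w)    ≈⟨ ×-congʳ n (*-identityˡ w) ⟩
        n · w           ≈⟨ Tr-fixed w∈Fq n ⟨
        Tr F q n w      ≈⟨ w∈Ker ⟩
        0#              ≈⟨ zeroˡ w ⟨
        0# * w          ∎))
        where
        t⊥n : Coprime t n
        t⊥n (i∣t , i∣n) = k⊥n (∣-trans i∣t (divides (gcd k r) k≡gcd[k,r]*t) , i∣n)
        z≈1 : z ≈ 1#
        z≈1 = trans (sym (*-identityʳ z)) (≡.subst (λ d → z ↑ d ≈ 1#) (coprime⇒gcd≡1 t⊥n)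
          (↑≈1-gcd {z} {t} {n} (trans (sym cᵉ≈zᵗ) cᵉ≈1) zⁿ≈1))
        w∈Fq : w ↑ q ≈ w
        w∈Fq = trans w↑q≈wz (trans (*-congˡ z≈1) (*-identityʳ w))

    Cases : ℕ → Set ℓ
    Cases e = (c ↑ e ≈ 1# × ¬ p ∣ n) ⊎ ¬ c ↑ (n ℕ.* e) ≈ 1#

    Ker∩f⁻¹0≈0 : Coprime k n → ∀ e → e *ℕ (p ^ gcd k r ∸ 1) ≡ q ∸ 1 → Cases e →
                 ∀ w → Ker w → f w ≈ 0# → w ≈ 0#
    Ker∩f⁻¹0≈0 k⊥n e e-def cases w w∈Ker fw≈0 with w ≟ 0#
    ... | yes w≈0 = w≈0
    ... | no  w≉0 = ⊥-elim (excluded cases)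
      where
      open Eigenvector k⊥n e e-def w≉0 (x-y≈0⇒x≈y fw≈0)
      excluded : Cases e → ⊥
      excluded (inj₁ (cᵉ≈1 , p∤n)) = p∤n (cᵉ≈1⇒p∣n w∈Ker cᵉ≈1)
      excluded (inj₂ c↑ne≉1)       = c↑ne≉1 c↑ne≈1

lemma4 : ∀ {a ℓ : Level} (F : Field a ℓ) (p r n k : ℕ) → Prime p → 1 ≤ r → 1 ≤ n →
    HasCardinality F ((p ^ r) ^ n) →
    1 ≤ k → gcd k n ≡ 1 →
    (c : Field.Carrier F) → InSubfield F (p ^ r) c →
    (e : ℕ) → e *ℕ (p ^ gcd k r ∸ 1) ≡ p ^ r ∸ 1 →
    ((Field._≈_ F (pow F c e) (Field.1# F) × ¬ (p ∣ n))
      ⊎ ¬ (Field._≈_ F (pow F c (n *ℕ e)) (Field.1# F))) →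
    Permutes F (λ x → Field._-_ F (pow F x (p ^ k)) (Field._*_ F c x)) (KerTr F (p ^ r) n)
lemma4 F p r n k p-prime _ _ card _ gcd[k,n]≡1 c c∈Fq e e-def cases =
  f-permutes-Ker (Ker∩f⁻¹0≈0 (gcd≡1⇒coprime gcd[k,n]≡1) e e-def cases)
  where open TraceKernel F p r n k p-prime card c c∈Fq
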